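{- Let $n$ be a positive integer. If the base-$b$ representation of $2^n$ (for some integer $b>1$) is a 3-digit representation of binomial form, i.e. $2^n=\alpha(1,2,1)_b$ meaning $2^n=\alpha+2\alpha b+\alpha b^2$ with $\alpha$ a positive integer and $2\alpha<b$, then $\alpha=2^i$ and $b=2^{(n-i)/2}-1$ for some integer $i$ with $0\le 3i<n-2$ and $n\equiv i\pmod 2$.
   Context: For an integer $b>1$, every positive integer $N$ can be written uniquely as $N=\sum_{i=0}^m c_i b^i$ with integers $0\le c_i<b$ and $c_m>0$; this is written $N=(c_m,\ldots,c_0)_b$. A representation has binomial form if its digits are $\alpha\binom{m}{m},\alpha\binom{m}{m-1},\ldots,\alpha\binom{m}{0}$ for some positive integer $\alpha$; for three digits ($m=2$) this is $\alpha(1,2,1)_b$. -}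

module Defs where

open import Data.Nat using (ℕ; _+_; _*_; _^_; _<_)
open import Data.Product using (_×_)
open import Relation.Binary.PropositionalEquality using (_≡_)

digits3 : ℕ → ℕ → ℕ → ℕ → ℕ
digits3 b c₂ c₁ c₀ = c₂ * b ^ 2 + c₁ * b + c₀

-- N = α(1,2,1)_b as a genuine base-b representation: α a positive integer,
-- digits α, 2α, α all < b (i.e. 2α < b), and N equals the value.
BinomialForm3 : ℕ → ℕ → ℕ → Set
BinomialForm3 b α N = (0 < α) × (2 * α < b) × (N ≡ digits3 b α (2 * α) α)

-- α(1,2,1)_b = α (b + 1)², so α (b + 1)² = 2ⁿ.  By unique factorisation α = 2^i and
-- b + 1 = 2^k with n = i + 2k; the digit bound 2α < b < 2^k then gives i + 1 < k,
-- hence 3i + 2 < n.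
module Submission where

open import Defs
open import Data.Nat using (ℕ; zero; suc; _+_; _*_; _^_; _<_; _∸_; s≤s; z≤n; NonZero; nonTrivial⇒n>1)
open import Data.Nat.Properties
open import Data.Nat.Divisibility using (divides)
open import Data.Nat.Primality using (Prime; euclidsLemma; prime[2]; prime⇒nonZero; prime⇒nonTrivial)
open import Data.Nat.Solver using (module +-*-Solver)
open import Data.Product using (_×_; _,_; ∃-syntax)
open import Data.Sum using (inj₁; inj₂)
open import Relation.Binary using (tri<; tri≈; tri>)
open import Relation.Binary.PropositionalEquality
  using (_≡_; refl; sym; trans; cong; subst; module ≡-Reasoning)
open import Relation.Nullary using (yes; no; contradiction)

^-injectiveʳ : ∀ {m} → 1 < m → ∀ {j k} → m ^ j ≡ m ^ k → j ≡ k
^-injectiveʳ {m} 1<m {j} {k} eq with <-cmp j k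
... | tri< j<k _ _ = contradiction eq (<⇒≢ (^-monoʳ-< m 1<m j<k))
... | tri≈ _ j≡k _ = j≡k
... | tri> _ _ k<j = contradiction (sym eq) (<⇒≢ (^-monoʳ-< m 1<m k<j))

^-cancelʳ-< : ∀ m .{{_ : NonZero m}} {j k} → m ^ j < m ^ k → j < k
^-cancelʳ-< m {j} {k} lt with j <? k
... | yes j<k = j<k
... | no j≮k  = contradiction (^-monoʳ-≤ m (≮⇒≥ j≮k)) (<⇒≱ lt)

*-cancel-factorˡ : ∀ {p x y} q m .{{_ : NonZero p}} →
  x ≡ q * p → x * y ≡ p * m → q * y ≡ m
*-cancel-factorˡ {p} {x} {y} q m x≡qp xy≡pm = *-cancelˡ-≡ (q * y) m p (begin
  p * (q * y)  ≡⟨ sym (*-assoc p q y) ⟩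
  p * q * y    ≡⟨ cong (_* y) (trans (*-comm p q) (sym x≡qp)) ⟩
  x * y        ≡⟨ xy≡pm ⟩
  p * m        ∎)
  where open ≡-Reasoning

*≡^⇒^*^ : ∀ {p} → Prime p → ∀ n x y → x * y ≡ p ^ n →
  ∃[ j ] ∃[ l ] (x ≡ p ^ j × y ≡ p ^ l × j + l ≡ n)
*≡^⇒^*^ pp zero x y xy≡1 = 0 , 0 , m*n≡1⇒m≡1 x y xy≡1 , m*n≡1⇒n≡1 x y xy≡1 , refl
*≡^⇒^*^ {p} pp (suc n) x y xy≡p^1+n
  with euclidsLemma x y pp (divides (p ^ n) (trans xy≡p^1+n (*-comm p (p ^ n))))
... | inj₁ (divides q x≡qp)
  with j , l , q≡ , y≡ , j+l≡n ← *≡^⇒^*^ pp n q y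
         (*-cancel-factorˡ q (p ^ n) {{prime⇒nonZero pp}} x≡qp xy≡p^1+n)
  = suc j , l , trans x≡qp (trans (*-comm q p) (cong (p *_) q≡)) , y≡ , cong suc j+l≡n
... | inj₂ (divides q y≡qp)
  with j , l , x≡ , q≡ , j+l≡n ← *≡^⇒^*^ pp n x q
         (trans (*-comm x q)
           (*-cancel-factorˡ q (p ^ n) {{prime⇒nonZero pp}} y≡qp (trans (*-comm y x) xy≡p^1+n)))
  = j , suc l , x≡ , trans y≡qp (trans (*-comm q p) (cong (p *_) q≡))
  , trans (+-suc j l) (cong suc j+l≡n)

square≡^⇒^ : ∀ {p} → Prime p → ∀ l x → x * x ≡ p ^ l → ∃[ k ] (x ≡ p ^ k × l ≡ 2 * k)
square≡^⇒^ {p} pp l x xx≡p^l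
  with j , j′ , x≡p^j , x≡p^j′ , j+j′≡l ← *≡^⇒^*^ pp l x x xx≡p^l
  with refl ← ^-injectiveʳ (nonTrivial⇒n>1 p {{prime⇒nonTrivial pp}}) {j} {j′}
                (trans (sym x≡p^j) x≡p^j′)
  = j , x≡p^j , trans (sym j+j′≡l) (cong (j +_) (sym (+-identityʳ j)))

digits3-binomial : ∀ b α → digits3 b α (2 * α) α ≡ α * ((b + 1) * (b + 1))
digits3-binomial = solve 2 (λ b α → α :* (b :^ 2) :+ (con 2 :* α) :* b :+ α
                                  := α :* ((b :+ con 1) :* (b :+ con 1))) refl
  where open +-*-Solver

1+i<k⇒3i+2<i+2k : ∀ {i k} → suc i < k → 3 * i + 2 < i + 2 * k
1+i<k⇒3i+2<i+2k {i} {k} 1+i<k = begin-strict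
  3 * i + 2          <⟨ +-monoʳ-< (3 * i) (s≤s (s≤s (s≤s z≤n))) ⟩
  3 * i + 4          ≡⟨ solve 1 (λ i → con 3 :* i :+ con 4 := i :+ con 2 :* (con 2 :+ i)) refl i ⟩
  i + 2 * (2 + i)    ≤⟨ +-monoʳ-≤ i (*-monoʳ-≤ 2 1+i<k) ⟩
  i + 2 * k          ∎
  where open ≤-Reasoning
        open +-*-Solver

theorem2p2 : (n b α : ℕ) → 0 < n → 1 < b → BinomialForm3 b α (2 ^ n) →
    ∃[ i ] ∃[ k ] (n ≡ i + 2 * k) × (α ≡ 2 ^ i) × (b ≡ 2 ^ k ∸ 1) × (3 * i + 2 < n)
theorem2p2 n b α _ _ (_ , 2α<b , 2^n≡digits)
  with i , l , α≡2^i , [b+1]²≡2^l , i+l≡n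
         ← *≡^⇒^*^ prime[2] n α ((b + 1) * (b + 1)) (sym (trans 2^n≡digits (digits3-binomial b α)))
  with k , b+1≡2^k , l≡2k ← square≡^⇒^ prime[2] l (b + 1) [b+1]²≡2^l
  = i , k , n≡i+2k , α≡2^i , b≡2^k∸1 , subst (3 * i + 2 <_) (sym n≡i+2k) (1+i<k⇒3i+2<i+2k 1+i<k)
  where
  n≡i+2k : n ≡ i + 2 * k
  n≡i+2k = trans (sym i+l≡n) (cong (i +_) l≡2k)

  b≡2^k∸1 : b ≡ 2 ^ k ∸ 1
  b≡2^k∸1 = trans (sym (m+n∸n≡m b 1)) (cong (_∸ 1) b+1≡2^k)

  1+i<k : suc i < k
  1+i<k = ^-cancelʳ-< 2 (subst (λ a → 2 * a < 2 ^ k) α≡2^i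
            (<-trans 2α<b (subst (b <_) b+1≡2^k (m<m+n b (s≤s z≤n)))))
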